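{- Let $(G,w)$ be a weighted trigraph, let $uv$ be a semi-adjacent pair of $G$, and let $(G',w')$ be the weighted trigraph obtained from $(G,w)$ by replacing $uv$ with a gem. Then $\alpha(G',w')=\alpha(G,w)$.
   Context: A trigraph $G$ consists of a finite set $V(G)$ and a function $\theta_G:\binom{V(G)}{2}\to\{ -1,0,1\}$; for distinct vertices $u,v$ write $uv$ for $\{u,v\}$. The pair $uv$ is strongly adjacent if $\theta_G(uv)=1$, semi-adjacent if $\theta_G(uv)=0$, strongly anti-adjacent if $\theta_G(uv)=-1$; $u,v$ are anti-adjacent if $\theta_G(uv)\le 0$. A stable set is a set of pairwise anti-adjacent vertices. Let $D(G)=V(G)\cup\{(u,v): u,v\in V(G),u\neq v\}\cup\binom{V(G)}{2}$. A weight function for $G$ is a map $w:D(G)\to\mathbb{N}$ such that for all distinct $u,v$: if $uv$ is not semi-adjacent then $w(u,v)=w(v,u)=w(uv)=0$, and $w(u,v)\le w(uv)$. A weighted trigraph is a pair $(G,w)$. For $S\subseteq V(G)$, $\mathrm{wt}_{(G,w)}(S)=\sum_{u\in S}w(u)+\sum_{u\in S}\sum_{v\in V(G)\setminus S}w(u,v)+\sum_{uv\in\binom{V(G)\setminus S}{2}}w(uv)$, and $\alpha(G,w)=\max\{\mathrm{wt}_{(G,w)}(S): S\text{ a stable set of }G\}$. Replacing a semi-adjacent pair $uv$ of $(G,w)$ with a gem yields $(G',w')$ where: $V(G')=V(G)\cup\{x_{uv},x_{v,u},x_{u,v}\}$ with three new distinct vertices; $\theta_{G'}$ agrees with $\theta_G$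 on $\binom{V(G)}{2}\setminus\{uv\}$; $\theta_{G'}(e)=1$ for $e\in\{ux_{v,u},\,x_{v,u}x_{u,v},\,x_{u,v}v,\,x_{uv}u,\,x_{uv}x_{v,u},\,x_{uv}x_{u,v},\,x_{uv}v\}$ and $\theta_{G'}(e)=-1$ for all other pairs (in particular $\theta_{G'}(uv)=-1$); $w'$ agrees with $w$ on $D(G)\setminus\{uv,(u,v),(v,u)\}$, $w'(x_{uv})=w(uv)$, $w'(x_{v,u})=w(v,u)$, $w'(x_{u,v})=w(u,v)$, and $w'(p)=0$ for all other $p\in D(G')$. -}

module Defs where

open import Data.Nat using (ℕ; zero; suc; _+_; _≤_; _⊔_)
open import Data.Fin using (Fin; zero; suc; splitAt; _≟_; _<?_)
open import Data.List using (List; []; _∷_; _++_; map; foldr; filter; allFin)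
open import Data.Nat.ListAction using (sum)
open import Data.Bool using (Bool; true; false; if_then_else_; _∧_; _∨_; not)
open import Data.Sum using (_⊎_; inj₁; inj₂)
open import Data.Product using (_×_)
open import Relation.Nullary using (¬_)
open import Relation.Nullary.Decidable using (⌊_⌋)
open import Relation.Binary.PropositionalEquality using (_≡_)

-- The adjacency value θ(uv) ∈ {-1,0,1}
-- is encoded as Adj; θ is given as a function on ordered pairs which is
-- required to be symmetric (so it is a function on unordered pairs).
-- Values on the diagonal (θ u u) are meaningless and never used.

data Adj : Set where
  antiS : Adj   -- -1 : strongly anti-adjacent
  semi  : Adj   --  0 : semi-adjacent
  strong : Adj  --  1 : strongly adjacent

Theta : ℕ → Set
Theta n = Fin n → Fin n → Adj

IsTrigraph : (n : ℕ) → Theta n → Set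
IsTrigraph n θ = ∀ (u v : Fin n) → ¬ (u ≡ v) → θ u v ≡ θ v u

antiB : Adj → Bool
antiB antiS  = true
antiB semi   = true
antiB strong = false

isSemi : Adj → Bool
isSemi semi = true
isSemi _    = false

-- A weight on D(G) consists of
--   wV u      = w(u)        for vertices,
--   wO u v    = w(u,v)      for ordered pairs of distinct vertices,
--   wU u v    = w(uv)       for unordered pairs (required symmetric).
-- Diagonal values wO u u, wU u u are never used.

record Weight (n : ℕ) : Set where
  constructor mkWeight
  field
    wV : Fin n → ℕ
    wO : Fin n → Fin n → ℕ
    wU : Fin n → Fin n → ℕ
open Weight public

IsWeightFunction : (n : ℕ) → Theta n → Weight n → Set
IsWeightFunction n θ w =
  (∀ (u v : Fin n) → ¬ (u ≡ v) → wU w u v ≡ wU w v u) ×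
  (∀ (u v : Fin n) → ¬ (u ≡ v) → ¬ (θ u v ≡ semi) →
      (wO w u v ≡ 0) × (wO w v u ≡ 0) × (wU w u v ≡ 0)) ×
  (∀ (u v : Fin n) → ¬ (u ≡ v) → wO w u v ≤ wU w u v)

Subset : ℕ → Set
Subset n = Fin n → Bool

allSubsets : (n : ℕ) → List (Subset n)
allSubsets zero = (λ ()) ∷ []
allSubsets (suc n) =
  map (λ S → ext false S) (allSubsets n) ++ map (λ S → ext true S) (allSubsets n)
  where
  ext : Bool → Subset n → Subset (suc n)
  ext b S zero    = b
  ext b S (suc i) = S i

neq : {n : ℕ} → Fin n → Fin n → Bool
neq u v = not ⌊ u ≟ v ⌋

isStable : (n : ℕ) → Theta n → Subset n → Bool
isStable n θ S =
  foldr _∧_ true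
    (map (λ u → foldr _∧_ true
       (map (λ v → if S u ∧ S v ∧ neq u v then antiB (θ u v) else true)
            (allFin n)))
     (allFin n))

-- wt_{(G,w)}(S); unordered pairs {u,v} are enumerated once as u < v.
wt : (n : ℕ) → Weight n → Subset n → ℕ
wt n w S =
  sum (map (λ u → if S u then wV w u else 0) (allFin n))
  + sum (map (λ u → sum (map (λ v → if S u ∧ not (S v) then wO w u v else 0)
                             (allFin n)))
             (allFin n))
  + sum (map (λ u → sum (map (λ v → if ⌊ u <? v ⌋ ∧ not (S u) ∧ not (S v)
                                      then wU w u v else 0)
                             (allFin n)))
             (allFin n))

-- α(G,w) = max of wt over stable sets (the empty set is stable, weights ≥ 0).
α : (n : ℕ) → Theta n → Weight n → ℕ
α n θ w = foldr _⊔_ 0 (map (wt n w) (filter (λ S → isStable n θ S ≡? true) (allSubsets n)))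
  where
  open import Data.Bool.Properties using () renaming (_≟_ to _≡?_)

-- Replacing the semi-adjacent pair uv with a gem.
-- V(G') = Fin (n + 3): old vertex i is  i ↑ˡ 3 ; the new vertices are
--   n ↑ʳ 0 = x_{uv},  n ↑ʳ 1 = x_{v,u},  n ↑ʳ 2 = x_{u,v}.

isPair : {n : ℕ} → Fin n → Fin n → Fin n → Fin n → Bool
isPair u v i j = (⌊ i ≟ u ⌋ ∧ ⌊ j ≟ v ⌋) ∨ (⌊ i ≟ v ⌋ ∧ ⌊ j ≟ u ⌋)

strongIf : Bool → Adj
strongIf true  = strong
strongIf false = antiS

oldNew : {n : ℕ} → Fin n → Fin n → Fin n → Fin 3 → Adj
oldNew u v i zero             = strongIf (⌊ i ≟ u ⌋ ∨ ⌊ i ≟ v ⌋)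
oldNew u v i (suc zero)       = strongIf ⌊ i ≟ u ⌋
oldNew u v i (suc (suc zero)) = strongIf ⌊ i ≟ v ⌋

newNew : Fin 3 → Fin 3 → Adj
newNew k l = strongIf (not ⌊ k ≟ l ⌋)

gemTheta : (n : ℕ) → Theta n → Fin n → Fin n → Theta (n + 3)
gemTheta n θ u v a b with splitAt n a | splitAt n b
... | inj₁ i | inj₁ j = if isPair u v i j then antiS else θ i j
... | inj₁ i | inj₂ k = oldNew u v i k
... | inj₂ k | inj₁ j = oldNew u v j k
... | inj₂ k | inj₂ l = newNew k l

gemWeight : (n : ℕ) → Weight n → Fin n → Fin n → Weight (n + 3)
gemWeight n w u v = mkWeight wV' wO' wU'
  where
  wV' : Fin (n + 3) → ℕ
  wV' a with splitAt n a
  ... | inj₁ i                = wV w i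
  ... | inj₂ zero             = wU w u v
  ... | inj₂ (suc zero)       = wO w v u
  ... | inj₂ (suc (suc zero)) = wO w u v
  wO' : Fin (n + 3) → Fin (n + 3) → ℕ
  wO' a b with splitAt n a | splitAt n b
  ... | inj₁ i | inj₁ j = if isPair u v i j then 0 else wO w i j
  ... | _      | _      = 0
  wU' : Fin (n + 3) → Fin (n + 3) → ℕ
  wU' a b with splitAt n a | splitAt n b
  ... | inj₁ i | inj₁ j = if isPair u v i j then 0 else wU w i j
  ... | _      | _      = 0

module Submission where

-- Let w₀ be w with the three pair weights a = w(u,v), b = w(v,u), c = w(uv)
-- set to 0.  Two weight identities drive the proof:
--   wt-pairGain  wt_w(S) = wt_{w₀}(S) + pairGain, where pairGain is a, b or c
--                according as only u, only v, or neither of u, v lies in S;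
--   wt-gem       w' restricts to w₀ on the old vertices and carries no pair
--                weight at the gem, so wt_{w'}(S') is wt_{w₀} of the old part
--                of S' plus the weights c, b, a of the gem vertices in S'.
-- (α ≤ α')  A stable set S of G plus the gem vertex x_{uv}, x_{v,u} or x_{u,v}
--           chosen by the same case split is stable in G' of equal weight.
-- (α' ≤ α)  The old part of a stable set of G' is stable in G (only uv changed
--           and it was semi-adjacent), and the gem's seven strong edges with
--           a, b ≤ c bound the gem's gain by pairGain.

open import Defs
open import Data.Nat using (ℕ; zero; suc; _+_; _≤_; _⊔_; z≤n)
open import Data.Nat.Properties
  using (+-identityʳ; +-assoc; +-monoˡ-≤; +-monoʳ-≤; ≤-refl; ≤-trans; ≤-reflexive; ≤-antisym;
         ⊔-lub; m≤m⊔n; m≤n⊔m; ≮⇒≥; module ≤-Reasoning)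
open import Data.Nat.ListAction using (sum)
open import Data.Nat.Tactic.RingSolver using (solve-∀)
open import Data.Fin using (Fin; zero; suc; _↑ˡ_; _↑ʳ_; splitAt; _≟_; _<?_)
open import Data.Fin.Properties
  using (suc-injective; toℕ-↑ˡ; splitAt-↑ˡ; splitAt-↑ʳ; ↑ˡ-injective; ↑ʳ-injective; <-asym)
  renaming (≤-antisym to ≤ᶠ-antisym)
open import Data.List using (List; []; _∷_; map; foldr; filter; allFin; tabulate)
open import Data.List.Properties using (map-tabulate)
open import Data.List.Relation.Unary.Any using (Any; here; there)
import Data.List.Relation.Unary.Any as Any
open import Data.List.Relation.Unary.Any.Properties using (++⁺ˡ; ++⁺ʳ; map⁺)
open import Data.Bool using (Bool; true; false; if_then_else_; _∧_; _∨_; not)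
open import Data.Bool.Properties using (∧-comm; ∨-zeroʳ) renaming (_≟_ to _≟ᵇ_)
open import Data.Maybe using (Maybe; just; nothing)
open import Data.Maybe.Properties using (just-injective)
open import Data.Sum using (_⊎_; inj₁; inj₂; [_,_]′)
open import Data.Product using (_×_; _,_)
open import Data.Empty using (⊥; ⊥-elim)
open import Relation.Nullary using (¬_; yes; no)
open import Relation.Nullary.Decidable using (⌊_⌋)
open import Relation.Unary using (Decidable)
open import Relation.Binary.PropositionalEquality
open import Function using (_∘_; id)

∑ : (n : ℕ) → (Fin n → ℕ) → ℕ
∑ n f = sum (tabulate f)

∑₂ : (n : ℕ) → (Fin n → Fin n → ℕ) → ℕ
∑₂ n F = ∑ n (λ i → ∑ n (F i))

sum-allFin : (n : ℕ) (f : Fin n → ℕ) → sum (map f (allFin n)) ≡ ∑ n f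
sum-allFin n f = cong sum (map-tabulate id f)

∑-cong : (n : ℕ) {f g : Fin n → ℕ} → (∀ i → f i ≡ g i) → ∑ n f ≡ ∑ n g
∑-cong zero    f≡g = refl
∑-cong (suc n) f≡g = cong₂ _+_ (f≡g zero) (∑-cong n (f≡g ∘ suc))

∑-zero : (n : ℕ) (f : Fin n → ℕ) → (∀ i → f i ≡ 0) → ∑ n f ≡ 0
∑-zero n f f≡0 = trans (∑-cong n f≡0) (∑-const0 n)
  where
  ∑-const0 : (n : ℕ) → ∑ n (λ _ → 0) ≡ 0
  ∑-const0 zero    = refl
  ∑-const0 (suc n) = ∑-const0 n

∑₂-cong : (n : ℕ) {F G : Fin n → Fin n → ℕ} → (∀ a b → F a b ≡ G a b) → ∑₂ n F ≡ ∑₂ n G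
∑₂-cong n F≡G = ∑-cong n (λ a → ∑-cong n (F≡G a))

∑-+ : (n : ℕ) (f g : Fin n → ℕ) → ∑ n (λ i → f i + g i) ≡ ∑ n f + ∑ n g
∑-+ zero    f g = refl
∑-+ (suc n) f g = begin
    f zero + g zero + ∑ n (λ i → f (suc i) + g (suc i))
  ≡⟨ cong (f zero + g zero +_) (∑-+ n (f ∘ suc) (g ∘ suc)) ⟩
    f zero + g zero + (∑ n (f ∘ suc) + ∑ n (g ∘ suc))
  ≡⟨ interchange (f zero) (g zero) _ _ ⟩
    f zero + ∑ n (f ∘ suc) + (g zero + ∑ n (g ∘ suc))
  ∎
  where
  open ≡-Reasoning
  interchange : (a b c d : ℕ) → a + b + (c + d) ≡ a + c + (b + d)
  interchange = solve-∀

∑-single : (n : ℕ) (f : Fin n → ℕ) (a : Fin n) → (∀ i → ¬ i ≡ a → f i ≡ 0) → ∑ n f ≡ f a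
∑-single (suc n) f zero    off = trans (cong (f zero +_) (∑-zero n (f ∘ suc) (λ i → off (suc i) λ ()))) (+-identityʳ _)
∑-single (suc n) f (suc a) off = begin
    f zero + ∑ n (f ∘ suc)  ≡⟨ cong (_+ ∑ n (f ∘ suc)) (off zero λ ()) ⟩
    ∑ n (f ∘ suc)           ≡⟨ ∑-single n (f ∘ suc) a (λ i i≢a → off (suc i) (i≢a ∘ suc-injective)) ⟩
    f (suc a)               ∎
  where open ≡-Reasoning

∑-↑ : (n m : ℕ) (f : Fin (n + m) → ℕ) → ∑ (n + m) f ≡ ∑ n (f ∘ (_↑ˡ m)) + ∑ m (f ∘ (n ↑ʳ_))
∑-↑ zero    m f = refl
∑-↑ (suc n) m f = trans (cong (f zero +_) (∑-↑ n m (f ∘ suc))) (sym (+-assoc (f zero) _ _))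

∑₂-single : (n : ℕ) (F : Fin n → Fin n → ℕ) (a b : Fin n) →
  (∀ i j → ¬ (i ≡ a × j ≡ b) → F i j ≡ 0) → ∑₂ n F ≡ F a b
∑₂-single n F a b off = begin
    ∑₂ n F        ≡⟨ ∑-single n _ a (λ i i≢a → ∑-zero n (F i) (λ j → off i j (λ (i≡a , _) → i≢a i≡a))) ⟩
    ∑ n (F a)     ≡⟨ ∑-single n (F a) b (λ j j≢b → off a j (λ (_ , j≡b) → j≢b j≡b)) ⟩
    F a b         ∎
  where open ≡-Reasoning

∑₂-↑ : (n m : ℕ) (F : Fin (n + m) → Fin (n + m) → ℕ) →
  (∀ i k → F (i ↑ˡ m) (n ↑ʳ k) ≡ 0) → (∀ k b → F (n ↑ʳ k) b ≡ 0) →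
  ∑₂ (n + m) F ≡ ∑₂ n (λ i j → F (i ↑ˡ m) (j ↑ˡ m))
∑₂-↑ n m F old-new new-any = begin
    ∑₂ (n + m) F
  ≡⟨ ∑-↑ n m _ ⟩
    ∑ n (λ i → ∑ (n + m) (F (i ↑ˡ m))) + ∑ m (λ k → ∑ (n + m) (F (n ↑ʳ k)))
  ≡⟨ cong₂ _+_ (∑-cong n oldRow) (∑-zero m _ (λ k → ∑-zero (n + m) _ (new-any k))) ⟩
    ∑₂ n (λ i j → F (i ↑ˡ m) (j ↑ˡ m)) + 0
  ≡⟨ +-identityʳ _ ⟩
    ∑₂ n (λ i j → F (i ↑ˡ m) (j ↑ˡ m))
  ∎
  where
  open ≡-Reasoning
  oldRow : ∀ i → ∑ (n + m) (F (i ↑ˡ m)) ≡ ∑ n (λ j → F (i ↑ˡ m) (j ↑ˡ m))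
  oldRow i = trans (∑-↑ n m _) (trans (cong (∑ n (λ j → F (i ↑ˡ m) (j ↑ˡ m)) +_) (∑-zero m _ (old-new i))) (+-identityʳ _))

∑₂-+ : (n : ℕ) (F G : Fin n → Fin n → ℕ) → ∑₂ n (λ i j → F i j + G i j) ≡ ∑₂ n F + ∑₂ n G
∑₂-+ n F G = trans (∑-cong n (λ i → ∑-+ n (F i) (G i))) (∑-+ n _ _)


vertexTerm : {n : ℕ} → Weight n → Subset n → Fin n → ℕ
vertexTerm w S a = if S a then wV w a else 0

outTerm : {n : ℕ} → Weight n → Subset n → Fin n → Fin n → ℕ
outTerm w S a b = if S a ∧ not (S b) then wO w a b else 0

pairTerm : {n : ℕ} → Weight n → Subset n → Fin n → Fin n → ℕ
pairTerm w S a b = if ⌊ a <? b ⌋ ∧ not (S a) ∧ not (S b) then wU w a b else 0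

wt-∑ : (n : ℕ) (w : Weight n) (S : Subset n) →
  wt n w S ≡ ∑ n (vertexTerm w S) + ∑₂ n (outTerm w S) + ∑₂ n (pairTerm w S)
wt-∑ n w S = cong₂ _+_ (cong₂ _+_ (sum-allFin n _) (rows (outTerm w S))) (rows (pairTerm w S))
  where
  rows : (F : Fin n → Fin n → ℕ) → sum (map (λ a → sum (map (F a) (allFin n))) (allFin n)) ≡ ∑₂ n F
  rows F = trans (sum-allFin n _) (∑-cong n (λ a → sum-allFin n (F a)))

wt-cong : (n : ℕ) (w : Weight n) {S T : Subset n} → (∀ a → S a ≡ T a) → wt n w S ≡ wt n w T
wt-cong n w {S} {T} S≡T = begin
    wt n w S
  ≡⟨ wt-∑ n w S ⟩
    ∑ n (vertexTerm w S) + ∑₂ n (outTerm w S) + ∑₂ n (pairTerm w S)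
  ≡⟨ cong₂ _+_ (cong₂ _+_ (∑-cong n λ a → cong (λ x → if x then wV w a else 0) (S≡T a))
                          (∑₂-cong n λ a b → cong₂ (λ x y → if x ∧ not y then wO w a b else 0) (S≡T a) (S≡T b)))
               (∑₂-cong n λ a b → cong₂ (λ x y → if ⌊ a <? b ⌋ ∧ not x ∧ not y then wU w a b else 0) (S≡T a) (S≡T b)) ⟩
    ∑ n (vertexTerm w T) + ∑₂ n (outTerm w T) + ∑₂ n (pairTerm w T)
  ≡⟨ sym (wt-∑ n w T) ⟩
    wt n w T
  ∎
  where
  open ≡-Reasoning

≟-refl : {n : ℕ} (i : Fin n) → ⌊ i ≟ i ⌋ ≡ true
≟-refl i with i ≟ i
... | yes _   = refl
... | no i≢i = ⊥-elim (i≢i refl)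

removePair : {n : ℕ} → Fin n → Fin n → Weight n → Weight n
removePair u v w = mkWeight (wV w)
  (λ i j → if isPair u v i j then 0 else wO w i j)
  (λ i j → if isPair u v i j then 0 else wU w i j)

∑₂-at : (n : ℕ) (F : Fin n → Fin n → ℕ) (a b : Fin n) →
  ∑₂ n (λ i j → if ⌊ i ≟ a ⌋ ∧ ⌊ j ≟ b ⌋ then F i j else 0) ≡ F a b
∑₂-at n F a b = trans (∑₂-single n _ a b off) atPoint
  where
  off : ∀ i j → ¬ (i ≡ a × j ≡ b) → (if ⌊ i ≟ a ⌋ ∧ ⌊ j ≟ b ⌋ then F i j else 0) ≡ 0
  off i j ≢ab with i ≟ a | j ≟ b
  ... | yes i≡a | yes j≡b = ⊥-elim (≢ab (i≡a , j≡b))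
  ... | yes _   | no _    = refl
  ... | no _    | _       = refl
  atPoint : (if ⌊ a ≟ a ⌋ ∧ ⌊ b ≟ b ⌋ then F a b else 0) ≡ F a b
  atPoint rewrite ≟-refl a | ≟-refl b = refl

∑₂-isPair : (n : ℕ) (F : Fin n → Fin n → ℕ) (u v : Fin n) → ¬ u ≡ v →
  ∑₂ n (λ i j → if isPair u v i j then F i j else 0) ≡ F u v + F v u
∑₂-isPair n F u v u≢v = begin
    ∑₂ n (λ i j → if isPair u v i j then F i j else 0)
  ≡⟨ ∑-cong n (λ i → ∑-cong n (λ j → split i j)) ⟩
    ∑₂ n (λ i j → at u v i j + at v u i j)
  ≡⟨ ∑₂-+ n (at u v) (at v u) ⟩
    ∑₂ n (at u v) + ∑₂ n (at v u)
  ≡⟨ cong₂ _+_ (∑₂-at n F u v) (∑₂-at n F v u) ⟩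
    F u v + F v u
  ∎
  where
  open ≡-Reasoning
  at : Fin n → Fin n → Fin n → Fin n → ℕ
  at a b i j = if ⌊ i ≟ a ⌋ ∧ ⌊ j ≟ b ⌋ then F i j else 0
  -- the two orderings of the pair are disjoint cases because u ≢ v
  split : ∀ i j → (if isPair u v i j then F i j else 0) ≡ at u v i j + at v u i j
  split i j with i ≟ u | i ≟ v | j ≟ v
  ... | yes refl | yes refl | _     = ⊥-elim (u≢v refl)
  ... | yes _    | no _     | yes _ = sym (+-identityʳ _)
  ... | yes _    | no _     | no _  = refl
  ... | no _     | _        | _     = refl

∑₂-removePair : (n : ℕ) (F : Fin n → Fin n → ℕ) (u v : Fin n) → ¬ u ≡ v →
  ∑₂ n F ≡ ∑₂ n (λ i j → if isPair u v i j then 0 else F i j) + (F u v + F v u)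
∑₂-removePair n F u v u≢v = begin
    ∑₂ n F
  ≡⟨ ∑-cong n (λ i → ∑-cong n (λ j → split (isPair u v i j) (F i j))) ⟩
    ∑₂ n (λ i j → (if isPair u v i j then 0 else F i j) + (if isPair u v i j then F i j else 0))
  ≡⟨ ∑₂-+ n _ _ ⟩
    ∑₂ n (λ i j → if isPair u v i j then 0 else F i j) + ∑₂ n (λ i j → if isPair u v i j then F i j else 0)
  ≡⟨ cong (∑₂ n (λ i j → if isPair u v i j then 0 else F i j) +_) (∑₂-isPair n F u v u≢v) ⟩
    ∑₂ n (λ i j → if isPair u v i j then 0 else F i j) + (F u v + F v u)
  ∎
  where
  open ≡-Reasoning
  split : (b : Bool) (x : ℕ) → x ≡ (if b then 0 else x) + (if b then x else 0)
  split true  x = refl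
  split false x = sym (+-identityʳ x)

wt-removePair : (n : ℕ) (w : Weight n) (S : Subset n) (u v : Fin n) → ¬ u ≡ v →
  wt n w S ≡ wt n (removePair u v w) S
           + (outTerm w S u v + outTerm w S v u + (pairTerm w S u v + pairTerm w S v u))
wt-removePair n w S u v u≢v = begin
    wt n w S
  ≡⟨ wt-∑ n w S ⟩
    V + ∑₂ n (outTerm w S) + ∑₂ n (pairTerm w S)
  ≡⟨ cong₂ (λ x y → V + x + y) (∑₂-removePair n _ u v u≢v) (∑₂-removePair n _ u v u≢v) ⟩
    V + (O₀ + o) + (P₀ + p)
  ≡⟨ rearrange V O₀ o P₀ p ⟩
    V + O₀ + P₀ + (o + p)
  ≡⟨ cong (_+ (o + p)) (cong₂ (λ x y → V + x + y) (∑₂-cong n (commute (wO w))) (∑₂-cong n (commute (wU w)))) ⟩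
    ∑ n (vertexTerm w' S) + ∑₂ n (outTerm w' S) + ∑₂ n (pairTerm w' S) + (o + p)
  ≡⟨ cong (_+ (o + p)) (sym (wt-∑ n w' S)) ⟩
    wt n w' S + (o + p)
  ∎
  where
  open ≡-Reasoning
  w' : Weight n
  w' = removePair u v w
  V O₀ P₀ o p : ℕ
  V  = ∑ n (vertexTerm w S)
  O₀ = ∑₂ n (λ i j → if isPair u v i j then 0 else outTerm w S i j)
  P₀ = ∑₂ n (λ i j → if isPair u v i j then 0 else pairTerm w S i j)
  o  = outTerm w S u v + outTerm w S v u
  p  = pairTerm w S u v + pairTerm w S v u
  rearrange : (a b c d e : ℕ) → a + (b + c) + (d + e) ≡ a + b + d + (c + e)
  rearrange = solve-∀
  commute : (M : Fin n → Fin n → ℕ) {c : Fin n → Fin n → Bool} → ∀ i j →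
    (if isPair u v i j then 0 else (if c i j then M i j else 0))
      ≡ (if c i j then (if isPair u v i j then 0 else M i j) else 0)
  commute M {c} i j with isPair u v i j | c i j
  ... | true  | true  = refl
  ... | true  | false = refl
  ... | false | _     = refl

pairGain : Bool → Bool → ℕ → ℕ → ℕ → ℕ
pairGain su sv a b c =
  (if su ∧ not sv then a else 0) + (if sv ∧ not su then b else 0) + (if not su ∧ not sv then c else 0)

-- w(uv) is counted once, under whichever of u < v, v < u holds.
pairTerm-both : {n : ℕ} (w : Weight n) (S : Subset n) (u v : Fin n) → ¬ u ≡ v → wU w v u ≡ wU w u v →
  pairTerm w S u v + pairTerm w S v u ≡ (if not (S u) ∧ not (S v) then wU w u v else 0)
pairTerm-both w S u v u≢v sym-uv with u <? v | v <? u
... | yes u<v | yes v<u = ⊥-elim (<-asym u<v v<u)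
... | yes _   | no _    = +-identityʳ _
... | no _    | yes _   = cong₂ (λ b x → if b then x else 0) (∧-comm (not (S v)) (not (S u))) sym-uv
... | no u≮v  | no v≮u  = ⊥-elim (u≢v (≤ᶠ-antisym (≮⇒≥ v≮u) (≮⇒≥ u≮v)))

wt-pairGain : (n : ℕ) (w : Weight n) (S : Subset n) (u v : Fin n) → ¬ u ≡ v → wU w v u ≡ wU w u v →
  wt n w S ≡ wt n (removePair u v w) S + pairGain (S u) (S v) (wO w u v) (wO w v u) (wU w u v)
wt-pairGain n w S u v u≢v sym-uv =
  trans (wt-removePair n w S u v u≢v)
        (cong (λ z → wt n (removePair u v w) S + (outTerm w S u v + outTerm w S v u + z))
              (pairTerm-both w S u v u≢v sym-uv))

data View (n m : ℕ) : Fin (n + m) → Set where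
  old : (i : Fin n) → View n m (i ↑ˡ m)
  new : (k : Fin m) → View n m (n ↑ʳ k)

view : (n m : ℕ) (a : Fin (n + m)) → View n m a
view zero    m a       = new a
view (suc n) m zero    = old zero
view (suc n) m (suc a) with view n m a
... | old i = old (suc i)
... | new k = new k

old≢new : (n m : ℕ) (i : Fin n) (k : Fin m) → ¬ (i ↑ˡ m) ≡ (n ↑ʳ k)
old≢new n m i k eq with trans (sym (splitAt-↑ˡ n i m)) (trans (cong (splitAt n) eq) (splitAt-↑ʳ n m k))
... | ()

restrict : {n : ℕ} (m : ℕ) → Subset (n + m) → Subset n
restrict m S' i = S' (i ↑ˡ m)

glue : {n m : ℕ} → Subset n → Subset m → Subset (n + m)
glue {n} S N a = [ S , N ]′ (splitAt n a)

glue-old : {n m : ℕ} (S : Subset n) (N : Subset m) (i : Fin n) → glue S N (i ↑ˡ m) ≡ S i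
glue-old {n} {m} S N i rewrite splitAt-↑ˡ n i m = refl

glue-new : {n m : ℕ} (S : Subset n) (N : Subset m) (k : Fin m) → glue S N (n ↑ʳ k) ≡ N k
glue-new {n} {m} S N k rewrite splitAt-↑ʳ n m k = refl

record Extends (n m : ℕ) (w' : Weight (n + m)) (w : Weight n) : Set where
  field
    vertex-old   : ∀ i → wV w' (i ↑ˡ m) ≡ wV w i
    out-old      : ∀ i j → wO w' (i ↑ˡ m) (j ↑ˡ m) ≡ wO w i j
    pair-old     : ∀ i j → wU w' (i ↑ˡ m) (j ↑ˡ m) ≡ wU w i j
    out-old-new  : ∀ i k → wO w' (i ↑ˡ m) (n ↑ʳ k) ≡ 0
    out-new      : ∀ k b → wO w' (n ↑ʳ k) b ≡ 0
    pair-old-new : ∀ i k → wU w' (i ↑ˡ m) (n ↑ʳ k) ≡ 0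
    pair-new     : ∀ k b → wU w' (n ↑ʳ k) b ≡ 0

wt-extend : (n m : ℕ) (w' : Weight (n + m)) (w : Weight n) → Extends n m w' w → (S' : Subset (n + m)) →
  wt (n + m) w' S' ≡ wt n w (restrict m S') + ∑ m (λ k → vertexTerm w' S' (n ↑ʳ k))
wt-extend n m w' w ext S' = begin
    wt (n + m) w' S'
  ≡⟨ wt-∑ (n + m) w' S' ⟩
    ∑ (n + m) (vertexTerm w' S') + ∑₂ (n + m) (outTerm w' S') + ∑₂ (n + m) (pairTerm w' S')
  ≡⟨ cong₂ (λ x y → x + y + ∑₂ (n + m) (pairTerm w' S')) (∑-↑ n m _)
       (∑₂-↑ n m _ (λ i k → if-zero (out-old-new i k)) (λ k b → if-zero (out-new k b))) ⟩
    ∑ n (λ i → vertexTerm w' S' (i ↑ˡ m)) + N + ∑₂ n (λ i j → outTerm w' S' (i ↑ˡ m) (j ↑ˡ m))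
      + ∑₂ (n + m) (pairTerm w' S')
  ≡⟨ cong (∑ n (λ i → vertexTerm w' S' (i ↑ˡ m)) + N + ∑₂ n (λ i j → outTerm w' S' (i ↑ˡ m) (j ↑ˡ m)) +_)
       (∑₂-↑ n m _ (λ i k → if-zero (pair-old-new i k)) (λ k b → if-zero (pair-new k b))) ⟩
    ∑ n (λ i → vertexTerm w' S' (i ↑ˡ m)) + N + ∑₂ n (λ i j → outTerm w' S' (i ↑ˡ m) (j ↑ˡ m))
      + ∑₂ n (λ i j → pairTerm w' S' (i ↑ˡ m) (j ↑ˡ m))
  ≡⟨ cong₂ (λ x y → x + N + y + _)
       (∑-cong n (λ i → cong (λ x → if S i then x else 0) (vertex-old i)))
       (∑₂-cong n (λ i j → cong (λ x → if S i ∧ not (S j) then x else 0) (out-old i j))) ⟩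
    ∑ n (vertexTerm w S) + N + ∑₂ n (outTerm w S) + ∑₂ n (λ i j → pairTerm w' S' (i ↑ˡ m) (j ↑ˡ m))
  ≡⟨ cong (∑ n (vertexTerm w S) + N + ∑₂ n (outTerm w S) +_)
       (∑₂-cong n (λ i j → cong₂ (λ b x → if b ∧ not (S i) ∧ not (S j) then x else 0)
                                  (<?-↑ˡ i j) (pair-old i j))) ⟩
    ∑ n (vertexTerm w S) + N + ∑₂ n (outTerm w S) + ∑₂ n (pairTerm w S)
  ≡⟨ rearrange (∑ n (vertexTerm w S)) N (∑₂ n (outTerm w S)) (∑₂ n (pairTerm w S)) ⟩
    ∑ n (vertexTerm w S) + ∑₂ n (outTerm w S) + ∑₂ n (pairTerm w S) + N
  ≡⟨ cong (_+ N) (sym (wt-∑ n w S)) ⟩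
    wt n w S + N
  ∎
  where
  open ≡-Reasoning
  open Extends ext
  S : Subset n
  S = restrict m S'
  N : ℕ
  N = ∑ m (λ k → vertexTerm w' S' (n ↑ʳ k))
  if-zero : {b : Bool} {x : ℕ} → x ≡ 0 → (if b then x else 0) ≡ 0
  if-zero {true}  x≡0 = x≡0
  if-zero {false} _   = refl
  <?-↑ˡ : (i j : Fin n) → ⌊ (i ↑ˡ m) <? (j ↑ˡ m) ⌋ ≡ ⌊ i <? j ⌋
  <?-↑ˡ i j rewrite toℕ-↑ˡ i m | toℕ-↑ˡ j m = refl
  rearrange : (a b c d : ℕ) → a + b + c + d ≡ a + c + d + b
  rearrange = solve-∀

all-true⁻ : (n : ℕ) (f : Fin n → Bool) → foldr _∧_ true (map f (allFin n)) ≡ true → ∀ i → f i ≡ true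
all-true⁻ n f all = go n f (trans (cong (foldr _∧_ true) (sym (map-tabulate id f))) all)
  where
  go : (n : ℕ) (f : Fin n → Bool) → foldr _∧_ true (tabulate f) ≡ true → ∀ i → f i ≡ true
  go (suc n) f all zero    with f zero | all
  ... | true | _    = refl
  go (suc n) f all (suc i) with f zero | all
  ... | true | rest = go n (f ∘ suc) rest i

all-true⁺ : (n : ℕ) (f : Fin n → Bool) → (∀ i → f i ≡ true) → foldr _∧_ true (map f (allFin n)) ≡ true
all-true⁺ n f every = trans (cong (foldr _∧_ true) (map-tabulate id f)) (go n f every)
  where
  go : (n : ℕ) (f : Fin n → Bool) → (∀ i → f i ≡ true) → foldr _∧_ true (tabulate f) ≡ true
  go zero    f every = refl
  go (suc n) f every rewrite every zero = go n (f ∘ suc) (every ∘ suc)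

Stable : (n : ℕ) → Theta n → Subset n → Set
Stable n θ S = ∀ a b → S a ≡ true → S b ≡ true → ¬ a ≡ b → antiB (θ a b) ≡ true

isStable-sound : (n : ℕ) (θ : Theta n) (S : Subset n) → isStable n θ S ≡ true → Stable n θ S
isStable-sound n θ S st a b Sa Sb a≢b =
  guarded (S a) (S b) (neq a b) _ (all-true⁻ n _ (all-true⁻ n _ st a) b) Sa Sb (neq-≢ a≢b)
  where
  guarded : (x y z r : Bool) → (if x ∧ y ∧ z then r else true) ≡ true → x ≡ true → y ≡ true → z ≡ true → r ≡ true
  guarded true true true r r≡true refl refl refl = r≡true
  neq-≢ : ¬ a ≡ b → neq a b ≡ true
  neq-≢ a≢b with a ≟ b
  ... | yes a≡b = ⊥-elim (a≢b a≡b)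
  ... | no _    = refl

isStable-complete : (n : ℕ) (θ : Theta n) (S : Subset n) → Stable n θ S → isStable n θ S ≡ true
isStable-complete n θ S stable = all-true⁺ n _ (λ a → all-true⁺ n _ (λ b →
  guarded (S a) (S b) (neq a b) _ (λ Sa Sb a≢b → stable a b Sa Sb (≢-neq a b a≢b))))
  where
  guarded : (x y z r : Bool) → (x ≡ true → y ≡ true → z ≡ true → r ≡ true) → (if x ∧ y ∧ z then r else true) ≡ true
  guarded true  true  true  r f = f refl refl refl
  guarded true  true  false r f = refl
  guarded true  false z     r f = refl
  guarded false y     z     r f = refl
  ≢-neq : (a b : Fin n) → neq a b ≡ true → ¬ a ≡ b
  ≢-neq a b ne with a ≟ b
  ≢-neq a b () | yes _
  ... | no a≢b = a≢b

module _ {A : Set} {P : A → Set} (P? : Decidable P) (f : A → ℕ) where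

  max-filter-≤ : {b : ℕ} → (∀ x → P x → f x ≤ b) → (L : List A) → foldr _⊔_ 0 (map f (filter P? L)) ≤ b
  max-filter-≤ bound []      = z≤n
  max-filter-≤ bound (x ∷ L) with P? x
  ... | yes Px = ⊔-lub (bound x Px) (max-filter-≤ bound L)
  ... | no _   = max-filter-≤ bound L

  ≤-max-filter : {m : ℕ} (L : List A) → Any (λ y → P y × m ≤ f y) L → m ≤ foldr _⊔_ 0 (map f (filter P? L))
  ≤-max-filter (x ∷ L) (here (Px , m≤fx)) with P? x
  ... | yes _  = ≤-trans m≤fx (m≤m⊔n _ _)
  ... | no ¬Px = ⊥-elim (¬Px Px)
  ≤-max-filter (x ∷ L) (there m∈L) with P? x
  ... | yes _  = ≤-trans (≤-max-filter L m∈L) (m≤n⊔m _ _)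
  ... | no _   = ≤-max-filter L m∈L

agree-zero-suc : {n : ℕ} {S₀ S : Subset (suc n)} → S₀ zero ≡ S zero → (∀ i → S₀ (suc i) ≡ S (suc i)) →
  ∀ i → S₀ i ≡ S i
agree-zero-suc at-zero at-suc zero    = at-zero
agree-zero-suc at-zero at-suc (suc i) = at-suc i

allSubsets-complete : (n : ℕ) (S : Subset n) → Any (λ S₀ → ∀ i → S₀ i ≡ S i) (allSubsets n)
allSubsets-complete zero    S = here (λ ())
allSubsets-complete (suc n) S with S zero in S₀≡
... | false = ++⁺ˡ (map⁺ (Any.map (agree-zero-suc (sym S₀≡)) (allSubsets-complete n (S ∘ suc))))
... | true  = ++⁺ʳ _ (map⁺ (Any.map (agree-zero-suc (sym S₀≡)) (allSubsets-complete n (S ∘ suc))))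

α-≤ : (n : ℕ) (θ : Theta n) (w : Weight n) {b : ℕ} → (∀ S → Stable n θ S → wt n w S ≤ b) → α n θ w ≤ b
α-≤ n θ w bound = max-filter-≤ (λ S → isStable n θ S ≟ᵇ true) (wt n w)
  (λ S st → bound S (isStable-sound n θ S st)) (allSubsets n)

≤-α : (n : ℕ) (θ : Theta n) (w : Weight n) (S : Subset n) → Stable n θ S → wt n w S ≤ α n θ w
≤-α n θ w S stable = ≤-max-filter (λ S → isStable n θ S ≟ᵇ true) (wt n w) (allSubsets n)
  (Any.map (λ S₀≡S → isStable-complete n θ _ (λ a b Sa Sb → stable a b (trans (sym (S₀≡S a)) Sa) (trans (sym (S₀≡S b)) Sb))
                   , ≤-reflexive (wt-cong n w (λ i → sym (S₀≡S i))))
           (allSubsets-complete n S))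

-- For a
-- stable set of G with membership bits su, sv of u and v, slot su sv is the
-- gem vertex added to it in G': x_{uv} if neither u nor v is in the set,
-- x_{v,u} if only v is, x_{u,v} if only u is, and none if both are.
slot : Bool → Bool → Maybe (Fin 3)
slot false false = just zero
slot false true  = just (suc zero)
slot true  false = just (suc (suc zero))
slot true  true  = nothing

inSlot : Maybe (Fin 3) → Subset 3
inSlot nothing  k = false
inSlot (just s) k = ⌊ s ≟ k ⌋

inSlot-just : (m : Maybe (Fin 3)) (k : Fin 3) → inSlot m k ≡ true → m ≡ just k
inSlot-just (just s) k chosen with s ≟ k
... | yes s≡k = cong just s≡k

gemGain : Bool → Bool → Bool → ℕ → ℕ → ℕ → ℕ
gemGain x₀ x₁ x₂ a b c = (if x₀ then c else 0) + (if x₁ then b else 0) + (if x₂ then a else 0)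

+0+0 : (x : ℕ) → x + 0 + 0 ≡ x
+0+0 x = trans (+-identityʳ (x + 0)) (+-identityʳ x)

∑-three : (a b c : ℕ) → a + (b + (c + 0)) ≡ a + b + c
∑-three a b c = trans (cong (λ x → a + (b + x)) (+-identityʳ c)) (sym (+-assoc a b c))

gemGain-slot : (su sv : Bool) (a b c : ℕ) →
  gemGain (inSlot (slot su sv) zero) (inSlot (slot su sv) (suc zero)) (inSlot (slot su sv) (suc (suc zero))) a b c
    ≡ pairGain su sv a b c
gemGain-slot false false a b c = +0+0 c
gemGain-slot false true  a b c = refl
gemGain-slot true  false a b c = sym (+0+0 a)
gemGain-slot true  true  a b c = refl

if-≤ : (x : Bool) (a : ℕ) → (if x then a else 0) ≤ a
if-≤ true  a = ≤-refl
if-≤ false a = z≤n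

clash : {x : Bool} → x ≡ true → x ≡ false → ⊥
clash refl ()

Excl : Bool → Bool → Set
Excl x y = x ≡ true → y ≡ true → ⊥

excluded : {x : Bool} → Excl true x → x ≡ false
excluded {false} _   = refl
excluded {true}  ex = ⊥-elim (ex refl refl)

gemGain-≤ : (su sv x₀ x₁ x₂ : Bool) (a b c : ℕ) → a ≤ c → b ≤ c →
  Excl su x₀ → Excl su x₁ → Excl sv x₀ → Excl sv x₂ → Excl x₀ x₁ → Excl x₀ x₂ → Excl x₁ x₂ →
  gemGain x₀ x₁ x₂ a b c ≤ pairGain su sv a b c
gemGain-≤ true true x₀ x₁ x₂ a b c _ _ u0 u1 _ v2 _ _ _
  rewrite excluded u0 | excluded u1 | excluded v2 = z≤n
gemGain-≤ true false x₀ x₁ x₂ a b c _ _ u0 u1 _ _ _ _ _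
  rewrite excluded u0 | excluded u1 = ≤-trans (if-≤ x₂ a) (≤-reflexive (sym (+0+0 a)))
gemGain-≤ false true x₀ x₁ x₂ a b c _ _ _ _ v0 v2 _ _ _
  rewrite excluded v0 | excluded v2 = +-monoˡ-≤ 0 (if-≤ x₁ b)
gemGain-≤ false false false false false a b c _ _ _ _ _ _ _ _ _ = z≤n
gemGain-≤ false false true  false false a b c _ _ _ _ _ _ _ _ _ = ≤-reflexive (+0+0 c)
gemGain-≤ false false false true  false a b c _ b≤c _ _ _ _ _ _ _ = ≤-trans (≤-reflexive (+-identityʳ b)) b≤c
gemGain-≤ false false false false true  a b c a≤c _ _ _ _ _ _ _ _ = a≤c
gemGain-≤ false false true  true  x₂    a b c _ _ _ _ _ _ ex _ _ = ⊥-elim (ex refl refl)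
gemGain-≤ false false true  false true  a b c _ _ _ _ _ _ _ ex _ = ⊥-elim (ex refl refl)
gemGain-≤ false false false true  true  a b c _ _ _ _ _ _ _ _ ex = ⊥-elim (ex refl refl)

isPair-cases : {n : ℕ} (u v a b : Fin n) → isPair u v a b ≡ true → (a ≡ u × b ≡ v) ⊎ (a ≡ v × b ≡ u)
isPair-cases u v a b pair with a ≟ u | b ≟ v | a ≟ v | b ≟ u
... | yes a≡u | yes b≡v | _       | _       = inj₁ (a≡u , b≡v)
... | _       | _       | yes a≡v | yes b≡u = inj₂ (a≡v , b≡u)
isPair-cases u v a b () | yes _ | no _ | yes _ | no _
isPair-cases u v a b () | yes _ | no _ | no _  | _
isPair-cases u v a b () | no _  | _    | yes _ | no _
isPair-cases u v a b () | no _  | _    | no _  | _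

slot-x₀ : {su sv : Bool} → slot su sv ≡ just zero → su ≡ false × sv ≡ false
slot-x₀ {false} {false} _  = refl , refl
slot-x₀ {false} {true}  ()
slot-x₀ {true}  {false} ()
slot-x₀ {true}  {true}  ()

slot-x₁ : {su sv : Bool} → slot su sv ≡ just (suc zero) → su ≡ false
slot-x₁ {false} {false} ()
slot-x₁ {false} {true}  _  = refl
slot-x₁ {true}  {false} ()
slot-x₁ {true}  {true}  ()

slot-x₂ : {su sv : Bool} → slot su sv ≡ just (suc (suc zero)) → sv ≡ false
slot-x₂ {false} {false} ()
slot-x₂ {false} {true}  ()
slot-x₂ {true}  {false} _  = refl
slot-x₂ {true}  {true}  ()

module Gem (n : ℕ) (θ : Theta n) (w : Weight n) (u v : Fin n) where

  θ' : Theta (n + 3)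
  θ' = gemTheta n θ u v

  w' : Weight (n + 3)
  w' = gemWeight n w u v

  x₀ x₁ x₂ : Fin (n + 3)
  x₀ = n ↑ʳ zero
  x₁ = n ↑ʳ suc zero
  x₂ = n ↑ʳ suc (suc zero)

  θ'-old-old : ∀ i j → θ' (i ↑ˡ 3) (j ↑ˡ 3) ≡ (if isPair u v i j then antiS else θ i j)
  θ'-old-old i j rewrite splitAt-↑ˡ n i 3 | splitAt-↑ˡ n j 3 = refl

  θ'-old-new : ∀ i k → θ' (i ↑ˡ 3) (n ↑ʳ k) ≡ oldNew u v i k
  θ'-old-new i k rewrite splitAt-↑ˡ n i 3 | splitAt-↑ʳ n 3 k = refl

  θ'-new-old : ∀ k i → θ' (n ↑ʳ k) (i ↑ˡ 3) ≡ oldNew u v i k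
  θ'-new-old k i rewrite splitAt-↑ˡ n i 3 | splitAt-↑ʳ n 3 k = refl

  θ'-new-new : ∀ k l → θ' (n ↑ʳ k) (n ↑ʳ l) ≡ newNew k l
  θ'-new-new k l rewrite splitAt-↑ʳ n 3 k | splitAt-↑ʳ n 3 l = refl

  w'-extends : Extends n 3 w' (removePair u v w)
  w'-extends = record
    { vertex-old = vertex-old ; out-old = out-old ; pair-old = pair-old
    ; out-old-new = out-old-new ; out-new = out-new ; pair-old-new = pair-old-new ; pair-new = pair-new }
    where
    vertex-old : ∀ i → wV w' (i ↑ˡ 3) ≡ wV w i
    vertex-old i rewrite splitAt-↑ˡ n i 3 = refl
    out-old : ∀ i j → wO w' (i ↑ˡ 3) (j ↑ˡ 3) ≡ wO (removePair u v w) i j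
    out-old i j rewrite splitAt-↑ˡ n i 3 | splitAt-↑ˡ n j 3 = refl
    pair-old : ∀ i j → wU w' (i ↑ˡ 3) (j ↑ˡ 3) ≡ wU (removePair u v w) i j
    pair-old i j rewrite splitAt-↑ˡ n i 3 | splitAt-↑ˡ n j 3 = refl
    out-old-new : ∀ i k → wO w' (i ↑ˡ 3) (n ↑ʳ k) ≡ 0
    out-old-new i k rewrite splitAt-↑ˡ n i 3 | splitAt-↑ʳ n 3 k = refl
    out-new : ∀ k b → wO w' (n ↑ʳ k) b ≡ 0
    out-new k b rewrite splitAt-↑ʳ n 3 k = refl
    pair-old-new : ∀ i k → wU w' (i ↑ˡ 3) (n ↑ʳ k) ≡ 0
    pair-old-new i k rewrite splitAt-↑ˡ n i 3 | splitAt-↑ʳ n 3 k = refl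
    pair-new : ∀ k b → wU w' (n ↑ʳ k) b ≡ 0
    pair-new k b rewrite splitAt-↑ʳ n 3 k = refl

  gem-vertex-weights : (S' : Subset (n + 3)) →
    ∑ 3 (λ k → vertexTerm w' S' (n ↑ʳ k)) ≡ gemGain (S' x₀) (S' x₁) (S' x₂) (wO w u v) (wO w v u) (wU w u v)
  gem-vertex-weights S'
    rewrite splitAt-↑ʳ n 3 zero | splitAt-↑ʳ n 3 (suc zero) | splitAt-↑ʳ n 3 (suc (suc zero)) =
    ∑-three (if S' x₀ then wU w u v else 0) (if S' x₁ then wO w v u else 0) (if S' x₂ then wO w u v else 0)

  wt-gem : (S' : Subset (n + 3)) →
    wt (n + 3) w' S' ≡ wt n (removePair u v w) (restrict 3 S')
                     + gemGain (S' x₀) (S' x₁) (S' x₂) (wO w u v) (wO w v u) (wU w u v)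
  wt-gem S' = trans (wt-extend n 3 w' (removePair u v w) w'-extends S')
                    (cong (wt n (removePair u v w) (restrict 3 S') +_) (gem-vertex-weights S'))

  -- The only old pair whose adjacency changes is uv, which was semi-adjacent,
  -- so the old part of a stable set of G' is stable in G.
  restrict-stable : IsTrigraph n θ → θ u v ≡ semi → ¬ u ≡ v →
    (S' : Subset (n + 3)) → Stable (n + 3) θ' S' → Stable n θ (restrict 3 S')
  restrict-stable trigraph uv-semi u≢v S' stable a b Sa Sb a≢b =
    unless-pair (isPair u v a b)
      (subst (λ x → antiB x ≡ true) (θ'-old-old a b) (stable (a ↑ˡ 3) (b ↑ˡ 3) Sa Sb (a≢b ∘ ↑ˡ-injective 3 a b)))
      (λ pair → cong antiB (pair-semi pair))
    where
    unless-pair : (p : Bool) {x : Adj} → antiB (if p then antiS else x) ≡ true → (p ≡ true → antiB x ≡ true) →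
      antiB x ≡ true
    unless-pair true  _    pair-case = pair-case refl
    unless-pair false anti _         = anti
    pair-semi : isPair u v a b ≡ true → θ a b ≡ semi
    pair-semi pair with isPair-cases u v a b pair
    ... | inj₁ (refl , refl) = uv-semi
    ... | inj₂ (refl , refl) = trans (trigraph v u (u≢v ∘ sym)) uv-semi

  gemExtension : Subset n → Subset (n + 3)
  gemExtension S = glue S (inSlot (slot (S u) (S v)))

  gemExtension-stable : (S : Subset n) → Stable n θ S → Stable (n + 3) θ' (gemExtension S)
  gemExtension-stable S stable a b Sa Sb a≢b = go (view n 3 a) (view n 3 b) Sa Sb a≢b
    where
    slot-avoids : ∀ i k → S i ≡ true → slot (S u) (S v) ≡ just k → antiB (oldNew u v i k) ≡ true
    slot-avoids i zero Si at with slot-x₀ at | i ≟ u | i ≟ v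
    ... | Su , _  | yes refl | _        = ⊥-elim (clash Si Su)
    ... | _  , Sv | no _     | yes refl = ⊥-elim (clash Si Sv)
    ... | _       | no _     | no _     = refl
    slot-avoids i (suc zero) Si at with i ≟ u
    ... | yes refl = ⊥-elim (clash Si (slot-x₁ at))
    ... | no _     = refl
    slot-avoids i (suc (suc zero)) Si at with i ≟ v
    ... | yes refl = ⊥-elim (clash Si (slot-x₂ at))
    ... | no _     = refl
    old-new : ∀ i k → S i ≡ true → inSlot (slot (S u) (S v)) k ≡ true → antiB (oldNew u v i k) ≡ true
    old-new i k Si chosen = slot-avoids i k Si (inSlot-just (slot (S u) (S v)) k chosen)
    in-old : ∀ i → gemExtension S (i ↑ˡ 3) ≡ true → S i ≡ true
    in-old i = trans (sym (glue-old S _ i))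
    in-new : ∀ k → gemExtension S (n ↑ʳ k) ≡ true → inSlot (slot (S u) (S v)) k ≡ true
    in-new k = trans (sym (glue-new S _ k))
    still-anti : (p : Bool) {x : Adj} → antiB x ≡ true → antiB (if p then antiS else x) ≡ true
    still-anti true  _    = refl
    still-anti false anti = anti
    go : ∀ {a b} → View n 3 a → View n 3 b → gemExtension S a ≡ true → gemExtension S b ≡ true → ¬ a ≡ b →
      antiB (θ' a b) ≡ true
    go (old i) (old j) Si Sj i≢j = subst (λ x → antiB x ≡ true) (sym (θ'-old-old i j))
      (still-anti (isPair u v i j) (stable i j (in-old i Si) (in-old j Sj) (i≢j ∘ cong (_↑ˡ 3))))
    go (old i) (new k) Si xk _   = subst (λ x → antiB x ≡ true) (sym (θ'-old-new i k)) (old-new i k (in-old i Si) (in-new k xk))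
    go (new k) (old i) xk Si _   = subst (λ x → antiB x ≡ true) (sym (θ'-new-old k i)) (old-new i k (in-old i Si) (in-new k xk))
    go (new k) (new l) xk xl k≢l = ⊥-elim (k≢l (cong (n ↑ʳ_) (just-injective
      (trans (sym (inSlot-just (slot (S u) (S v)) k (in-new k xk))) (inSlot-just (slot (S u) (S v)) l (in-new l xl))))))

  wt-gemExtension : (S : Subset n) →
    wt (n + 3) w' (gemExtension S)
      ≡ wt n (removePair u v w) S + pairGain (S u) (S v) (wO w u v) (wO w v u) (wU w u v)
  wt-gemExtension S = begin
      wt (n + 3) w' (gemExtension S)
    ≡⟨ wt-gem (gemExtension S) ⟩
      wt n (removePair u v w) (restrict 3 (gemExtension S))
        + gemGain (gemExtension S x₀) (gemExtension S x₁) (gemExtension S x₂) (wO w u v) (wO w v u) (wU w u v)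
    ≡⟨ cong₂ _+_ (wt-cong n (removePair u v w) (glue-old S _))
                 (cong₃ (λ y₀ y₁ y₂ → gemGain y₀ y₁ y₂ (wO w u v) (wO w v u) (wU w u v))
                        (glue-new S _ zero) (glue-new S _ (suc zero)) (glue-new S _ (suc (suc zero)))) ⟩
      wt n (removePair u v w) S
        + gemGain (inSlot (slot (S u) (S v)) zero) (inSlot (slot (S u) (S v)) (suc zero))
                  (inSlot (slot (S u) (S v)) (suc (suc zero))) (wO w u v) (wO w v u) (wU w u v)
    ≡⟨ cong (wt n (removePair u v w) S +_) (gemGain-slot (S u) (S v) (wO w u v) (wO w v u) (wU w u v)) ⟩
      wt n (removePair u v w) S + pairGain (S u) (S v) (wO w u v) (wO w v u) (wU w u v)
    ∎
    where
    open ≡-Reasoning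
    cong₃ : {A : Set} (f : Bool → Bool → Bool → A) {a b c a' b' c' : Bool} →
      a ≡ a' → b ≡ b' → c ≡ c' → f a b c ≡ f a' b' c'
    cong₃ f refl refl refl = refl

  u-x₀ : θ' (u ↑ˡ 3) x₀ ≡ strong
  u-x₀ rewrite θ'-old-new u zero | ≟-refl u = refl
  v-x₀ : θ' (v ↑ˡ 3) x₀ ≡ strong
  v-x₀ rewrite θ'-old-new v zero | ≟-refl v | ∨-zeroʳ ⌊ v ≟ u ⌋ = refl
  u-x₁ : θ' (u ↑ˡ 3) x₁ ≡ strong
  u-x₁ rewrite θ'-old-new u (suc zero) | ≟-refl u = refl
  v-x₂ : θ' (v ↑ˡ 3) x₂ ≡ strong
  v-x₂ rewrite θ'-old-new v (suc (suc zero)) | ≟-refl v = refl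
  x₀-x₁ : θ' x₀ x₁ ≡ strong
  x₀-x₁ = θ'-new-new zero (suc zero)
  x₀-x₂ : θ' x₀ x₂ ≡ strong
  x₀-x₂ = θ'-new-new zero (suc (suc zero))
  x₁-x₂ : θ' x₁ x₂ ≡ strong
  x₁-x₂ = θ'-new-new (suc zero) (suc (suc zero))

  strong-excl : (S' : Subset (n + 3)) → Stable (n + 3) θ' S' → ∀ {a b} → ¬ a ≡ b → θ' a b ≡ strong →
    Excl (S' a) (S' b)
  strong-excl S' stable {a} {b} a≢b a-b Sa Sb = clash (stable a b Sa Sb a≢b) (cong antiB a-b)

  gemGain-restrict : (S' : Subset (n + 3)) → Stable (n + 3) θ' S' →
    wO w u v ≤ wU w u v → wO w v u ≤ wU w u v →
    gemGain (S' x₀) (S' x₁) (S' x₂) (wO w u v) (wO w v u) (wU w u v)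
      ≤ pairGain (S' (u ↑ˡ 3)) (S' (v ↑ˡ 3)) (wO w u v) (wO w v u) (wU w u v)
  gemGain-restrict S' stable a≤c b≤c = gemGain-≤ _ _ _ _ _ _ _ _ a≤c b≤c
    (excl (old≢new n 3 u zero) u-x₀) (excl (old≢new n 3 u (suc zero)) u-x₁)
    (excl (old≢new n 3 v zero) v-x₀) (excl (old≢new n 3 v (suc (suc zero))) v-x₂)
    (excl (new≢new λ ()) x₀-x₁) (excl (new≢new λ ()) x₀-x₂) (excl (new≢new λ ()) x₁-x₂)
    where
    excl : ∀ {a b} → ¬ a ≡ b → θ' a b ≡ strong → Excl (S' a) (S' b)
    excl = strong-excl S' stable
    new≢new : {k l : Fin 3} → ¬ k ≡ l → ¬ (n ↑ʳ k) ≡ (n ↑ʳ l)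
    new≢new {k} {l} k≢l = k≢l ∘ ↑ʳ-injective n k l

proposition5p1 : (n : ℕ) (θ : Theta n) (w : Weight n) →
    IsTrigraph n θ → IsWeightFunction n θ w →
    (u v : Fin n) → ¬ (u ≡ v) → θ u v ≡ semi →
    α (n + 3) (gemTheta n θ u v) (gemWeight n w u v) ≡ α n θ w
proposition5p1 n θ w trigraph (wU-sym , _ , wO≤wU) u v u≢v uv-semi = ≤-antisym α'≤α α≤α'
  where
  open Gem n θ w u v
  open ≤-Reasoning
  w₀ : Weight n
  w₀ = removePair u v w
  wU-vu : wU w v u ≡ wU w u v
  wU-vu = wU-sym v u (u≢v ∘ sym)
  a≤c : wO w u v ≤ wU w u v
  a≤c = wO≤wU u v u≢v
  b≤c : wO w v u ≤ wU w u v
  b≤c = ≤-trans (wO≤wU v u (u≢v ∘ sym)) (≤-reflexive wU-vu)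
  gain : Subset n → ℕ
  gain S = pairGain (S u) (S v) (wO w u v) (wO w v u) (wU w u v)

  α'≤α : α (n + 3) θ' w' ≤ α n θ w
  α'≤α = α-≤ (n + 3) θ' w' λ S' stable → begin
    wt (n + 3) w' S'
      ≡⟨ wt-gem S' ⟩
    wt n w₀ (restrict 3 S') + gemGain (S' x₀) (S' x₁) (S' x₂) (wO w u v) (wO w v u) (wU w u v)
      ≤⟨ +-monoʳ-≤ (wt n w₀ (restrict 3 S')) (gemGain-restrict S' stable a≤c b≤c) ⟩
    wt n w₀ (restrict 3 S') + gain (restrict 3 S')
      ≡⟨ sym (wt-pairGain n w (restrict 3 S') u v u≢v wU-vu) ⟩
    wt n w (restrict 3 S')
      ≤⟨ ≤-α n θ w _ (restrict-stable trigraph uv-semi u≢v S' stable) ⟩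
    α n θ w ∎

  α≤α' : α n θ w ≤ α (n + 3) θ' w'
  α≤α' = α-≤ n θ w λ S stable → begin
    wt n w S                            ≡⟨ wt-pairGain n w S u v u≢v wU-vu ⟩
    wt n w₀ S + gain S                  ≡⟨ sym (wt-gemExtension S) ⟩
    wt (n + 3) w' (gemExtension S)      ≤⟨ ≤-α (n + 3) θ' w' _ (gemExtension-stable S stable) ⟩
    α (n + 3) θ' w' ∎
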